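{- Let $a$ be a positive integer and let $P_a=\{C_{i,a+1}:1\le i\le 2a+1\}\cup\{C_{a+1,j}:1\le j\le 2a+1\}$, the plus-shaped polyomino of size $n=4a+1$. Then on the $n\times n$ board, $\mathrm{cp}_{\mathrm{fixed}}(P_a)=\mathrm{cp}_{\mathrm{free}}(P_a)=1$.
   Context: A cell $C_{i,j}$ ($i,j$ integers) is the closed unit square in column $i$ and row $j$ of the integer grid. A polyomino is a finite set of cells; its size is its number of cells. For a polyomino $\mathcal P$ of size $n$, the board is $\mathbb B=\{C_{i,j}:1\le i,j\le n\}$. A shift of $\mathcal P$ by an integer pair $(c,d)$ is $\{C_{x+c,y+d}:C_{x,y}\in\mathcal P\}$. Two polyominoes are fixed equivalent if one is a shift of the other, and free equivalent if one is obtained from the other by a rotation by an integer multiple of $90^\circ$ followed by a shift. A set of polyominoes is a valid arrangement if all lie in $\mathbb B$ and they are pairwise disjoint. A fixed (resp. free) packing of $\mathcal P$ is a valid arrangement of polyominoes fixed (resp. free) equivalent to $\mathcal P$ such that adding any further polyomino fixed (resp. free) equivalent to $\mathcal P$ yields an invalid arrangement. The clumsy fixed (resp. free) packing number $\mathrm{cp}_{\mathrm{fixed}}(\mathcal P)$ (resp. $\mathrm{cp}_{\mathrm{free}}(\mathcal P)$) is the minimum number of polyominoes in a fixed (resp. free) packing of $\mathcal P$ on the $n\times n$ board, $n=|\mathcal P|$. Since $P_a$ is invariant under $90^\circ$ rotations, the paper writes $\mathrm{cp}(P_a)$ for the common value. -}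

module Defs where

open import Data.Nat using (ℕ; zero; suc; _+_; _*_; _≤_)
open import Relation.Binary.PropositionalEquality using (_≡_)
open import Data.Integer as ℤ using (ℤ; +_; -_) renaming (_+_ to _+ℤ_; _≤_ to _≤ℤ_)
open import Data.Product using (_×_; _,_; Σ; ∃; ∃-syntax)
open import Data.List using (List; []; _∷_; map; upTo; length; _++_)
open import Data.List.Membership.Propositional using (_∈_)
open import Data.List.Relation.Unary.All using (All)
open import Data.List.Relation.Unary.AllPairs using (AllPairs)
open import Data.Fin using (Fin)
open import Data.Empty using (⊥)
open import Relation.Nullary using (¬_)
open import Function.Bundles using (_⇔_)

-- A cell C_{i,j} is identified with its integer coordinates (column i, row j).
Cell : Set
Cell = ℤ × ℤ

-- A polyomino is a finite set of cells, represented by a list of cells;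
-- lists are compared as sets (via membership), see _≃_ below.
Polyomino : Set
Polyomino = List Cell

_≃_ : Polyomino → Polyomino → Set
P ≃ Q = ∀ (x : Cell) → (x ∈ P) ⇔ (x ∈ Q)

shift : ℤ → ℤ → Polyomino → Polyomino
shift c d = map (λ { (x , y) → (x +ℤ c , y +ℤ d) })

rot90 : Polyomino → Polyomino
rot90 = map (λ { (x , y) → (- y , x) })

rotate : ℕ → Polyomino → Polyomino
rotate zero    P = P
rotate (suc k) P = rot90 (rotate k P)

FixedEquiv : Polyomino → Polyomino → Set
FixedEquiv P Q = ∃[ c ] ∃[ d ] (Q ≃ shift c d P)

FreeEquiv : Polyomino → Polyomino → Set
FreeEquiv P Q = ∃[ k ] ∃[ c ] ∃[ d ] (Q ≃ shift c d (rotate k P))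

InBoard : ℕ → Cell → Set
InBoard n (i , j) = (+ 1 ≤ℤ i × i ≤ℤ + n) × (+ 1 ≤ℤ j × j ≤ℤ + n)

Disjoint : Polyomino → Polyomino → Set
Disjoint P Q = ∀ (x : Cell) → x ∈ P → x ∈ Q → ⊥

ValidArrangement : ℕ → List Polyomino → Set
ValidArrangement n A = All (All (InBoard n)) A × AllPairs Disjoint A

IsPacking : (Polyomino → Polyomino → Set) → Polyomino → List Polyomino → Set
IsPacking Eqv P A =
  All (Eqv P) A × ValidArrangement (length P) A ×
  (∀ (Q : Polyomino) → Eqv P Q → ¬ ValidArrangement (length P) (Q ∷ A))

ClumsyPackingNumberIs : (Polyomino → Polyomino → Set) → Polyomino → ℕ → Set
ClumsyPackingNumberIs Eqv P k =
  (∃[ A ] (IsPacking Eqv P A × length A ≡ k)) ×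
  (∀ (A : List Polyomino) → IsPacking Eqv P A → k ≤ length A)

-- The plus-shaped polyomino P_a (listed without repetitions, so its size is 4a+1):
-- row a+1 : C_{i,a+1}, 1 ≤ i ≤ 2a+1
-- column a+1 : C_{a+1,j}, 1 ≤ j ≤ a and a+2 ≤ j ≤ 2a+1
plus : ℕ → Polyomino
plus a =
  map (λ i → (+ suc i , + suc a)) (upTo (suc (2 * a))) ++
  map (λ j → (+ suc a , + suc j)) (upTo a) ++
  map (λ j → (+ suc a , + (suc (suc a) + j))) (upTo a)

{-# OPTIONS --safe #-}
module Submission where

-- Every copy Q of P_a (shifted or rotated) that lies in the (4a+1) × (4a+1) board
-- contains a cross of radius a whose centre (x, y) satisfies a+1 ≤ x, y ≤ 3a+1.
-- Hence Q and the copy Z centred at the middle cell (2a+1, 2a+1) share the cell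
-- (2a+1, y): it lies on the horizontal arm of Q and on the vertical arm of Z.
-- So {Z} is already a packing, and the empty arrangement is not one.

open import Defs
open import Data.Nat as ℕ using (ℕ; zero; suc; _≤_; _<_; z≤n; s≤s)
import Data.Nat.Properties as ℕP
open import Data.Integer as ℤ
  using (ℤ; +_; -[1+_]; -_; _-_; 0ℤ; +≤+; ∣_∣) renaming (_+_ to _+ℤ_; _≤_ to _≤ℤ_)
import Data.Integer.Properties as ℤP
open import Data.Integer.Tactic.RingSolver using (solve-∀)
open import Data.Product using (_×_; _,_; proj₁; proj₂; ∃-syntax)
open import Data.Sum using (inj₁; inj₂)
open import Data.List using ([]; _∷_; map; upTo; length; _++_)
open import Data.List.Properties using (length-++; length-map; length-upTo)
open import Data.List.Membership.Propositional using (_∈_)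
open import Data.List.Membership.Propositional.Properties
  using (∈-map⁺; ∈-map⁻; ∈-++⁺ˡ; ∈-++⁺ʳ; ∈-++⁻; ∈-upTo⁺; ∈-upTo⁻)
open import Data.List.Relation.Unary.All using (All; []; _∷_; lookup; tabulate)
open import Data.List.Relation.Unary.AllPairs using ([]; _∷_)
open import Data.Empty using (⊥-elim)
open import Relation.Nullary using (¬_)
open import Relation.Binary.PropositionalEquality
  using (_≡_; refl; sym; trans; cong; cong₂; subst; module ≡-Reasoning)
open import Function.Bundles using (Equivalence)
open import Function.Construct.Identity using (⇔-id)

≤-by-equal-gap : ∀ {u v x y} → v - u ≡ y - x → u ≤ℤ v → x ≤ℤ y
≤-by-equal-gap gap u≤v = ℤP.0≤i-j⇒j≤i (subst (0ℤ ≤ℤ_) gap (ℤP.i≤j⇒0≤j-i u≤v))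

Within : ℕ → ℤ → Set
Within a t = - + a ≤ℤ t × t ≤ℤ + a

Within-neg : ∀ {a t} → Within a t → Within a (- t)
Within-neg {a} {t} (-a≤t , t≤a) =
  ℤP.neg-mono-≤ t≤a , subst (- t ≤ℤ_) (ℤP.neg-involutive (+ a)) (ℤP.neg-mono-≤ -a≤t)

Within-radius : ∀ a → Within a (+ a)
Within-radius a = ℤP.neg-≤-pos , ℤP.≤-refl

Within-neg-radius : ∀ a → Within a (- + a)
Within-neg-radius a = Within-neg (Within-radius a)

Cross : ℕ → Polyomino → Cell → Set
Cross a P (x , y) = ∀ t → Within a t → ((x +ℤ t , y) ∈ P) × ((x , y +ℤ t) ∈ P)

Cross-resp-≃ : ∀ {a P Q c} → Q ≃ P → Cross a P c → Cross a Q c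
Cross-resp-≃ Q≃P cross t w =
  Equivalence.from (Q≃P _) (proj₁ (cross t w)) , Equivalence.from (Q≃P _) (proj₂ (cross t w))

Cross-shift : ∀ {a P x y} c d → Cross a P (x , y) → Cross a (shift c d P) (x +ℤ c , y +ℤ d)
Cross-shift {P = P} {x} {y} c d cross t w =
  subst (λ u → (u , y +ℤ d) ∈ shift c d P) (+-swapʳ x t c) (∈-map⁺ _ (proj₁ (cross t w))) ,
  subst (λ u → (x +ℤ c , u) ∈ shift c d P) (+-swapʳ y t d) (∈-map⁺ _ (proj₂ (cross t w)))
  where
  +-swapʳ : ∀ x t c → x +ℤ t +ℤ c ≡ x +ℤ c +ℤ t
  +-swapʳ = solve-∀

Cross-rot90 : ∀ {a P x y} → Cross a P (x , y) → Cross a (rot90 P) (- y , x)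
Cross-rot90 {P = P} {x} {y} cross t w =
  subst (λ u → (u , x) ∈ rot90 P) (neg-minus y t) (∈-map⁺ _ (proj₂ (cross (- t) (Within-neg w)))) ,
  ∈-map⁺ _ (proj₁ (cross t w))
  where
  neg-minus : ∀ y t → - (y - t) ≡ - y +ℤ t
  neg-minus = solve-∀

Cross-rotate : ∀ {a P c} k → Cross a P c → ∃[ c′ ] Cross a (rotate k P) c′
Cross-rotate {c = c} zero    cross = c , cross
Cross-rotate         (suc k) cross with Cross-rotate k cross
... | (x , y) , cross′ = (- y , x) , Cross-rot90 cross′

Cross-meet : ∀ {a P Q px py qx qy} → Cross a P (px , py) → Cross a Q (qx , qy) →
             Within a (qx - px) → Within a (py - qy) → ¬ Disjoint P Q
Cross-meet {P = P} {Q} {px} {py} {qx} {qy} crossP crossQ wx wy disjoint =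
  disjoint (qx , py)
    (subst (λ u → (u , py) ∈ P) (plus-minus px qx) (proj₁ (crossP (qx - px) wx)))
    (subst (λ u → (qx , u) ∈ Q) (plus-minus qy py) (proj₂ (crossQ (py - qy) wy)))
  where
  plus-minus : ∀ p q → p +ℤ (q - p) ≡ q
  plus-minus = solve-∀

row : ℕ → Polyomino
row a = map (λ i → (+ suc i , + suc a)) (upTo (suc (2 ℕ.* a)))

lower-column : ℕ → Polyomino
lower-column a = map (λ j → (+ suc a , + suc j)) (upTo a)

upper-column : ℕ → Polyomino
upper-column a = map (λ j → (+ suc a , + (suc (suc a) ℕ.+ j))) (upTo a)

row∈plus : ∀ a {i} → i ≤ 2 ℕ.* a → (+ suc i , + suc a) ∈ plus a
row∈plus a i≤2a = ∈-++⁺ˡ (∈-map⁺ _ (∈-upTo⁺ (s≤s i≤2a)))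

lower∈plus : ∀ a {j} → j < a → (+ suc a , + suc j) ∈ plus a
lower∈plus a j<a = ∈-++⁺ʳ (row a) (∈-++⁺ˡ (∈-map⁺ _ (∈-upTo⁺ j<a)))

upper∈plus : ∀ a {j} → j < a → (+ suc a , + (suc (suc a) ℕ.+ j)) ∈ plus a
upper∈plus a j<a = ∈-++⁺ʳ (row a) (∈-++⁺ʳ (lower-column a) (∈-map⁺ _ (∈-upTo⁺ j<a)))

a≤2a : ∀ a → a ≤ 2 ℕ.* a
a≤2a a = ℕP.m≤m+n a (a ℕ.+ 0)

index-from-left : ∀ {a t} → - + a ≤ℤ t → + ∣ t +ℤ + a ∣ ≡ t +ℤ + a
index-from-left {a} {t} -a≤t = ℤP.0≤i⇒+∣i∣≡i (≤-by-equal-gap (gap (+ a) t) -a≤t)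
  where
  gap : ∀ a t → t - (- a) ≡ (t +ℤ a) - 0ℤ
  gap = solve-∀

one-plus-index : ∀ a t → + 1 +ℤ (t +ℤ + a) ≡ + suc a +ℤ t
one-plus-index a t = shuffle (+ a) t
  where
  shuffle : ∀ a t → + 1 +ℤ (t +ℤ a) ≡ (+ 1 +ℤ a) +ℤ t
  shuffle = solve-∀

plus-row : ∀ a t → Within a t → (+ suc a +ℤ t , + suc a) ∈ plus a
plus-row a t (-a≤t , t≤a) =
  subst (λ u → (u , + suc a) ∈ plus a) index≡ (row∈plus a (ℤP.drop‿+≤+ bound))
  where
  i = ∣ t +ℤ + a ∣
  index≡ : + suc i ≡ + suc a +ℤ t
  index≡ = trans (cong (+ 1 +ℤ_) (index-from-left -a≤t)) (one-plus-index a t)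
  -- The solver identities are stated on the definitional unfoldings of the ℕ literals,
  -- e.g. + (2 ℕ.* a) = a +ℤ (a +ℤ 0ℤ) and -[1+ n ] = - (+ 1 +ℤ n).
  gap : ∀ a t → a - t ≡ (a +ℤ (a +ℤ 0ℤ)) - (t +ℤ a)
  gap = solve-∀
  bound : + i ≤ℤ + (2 ℕ.* a)
  bound = subst (_≤ℤ + (2 ℕ.* a)) (sym (index-from-left -a≤t))
                (≤-by-equal-gap (gap (+ a) t) t≤a)

plus-column : ∀ a t → Within a t → (+ suc a , + suc a +ℤ t) ∈ plus a
plus-column a (+ zero) _ =
  subst (λ u → (+ suc a , u) ∈ plus a) (sym (ℤP.+-identityʳ _)) (row∈plus a (a≤2a a))
plus-column a (+ suc n) (_ , t≤a) =
  subst (λ u → (+ suc a , u) ∈ plus a) (cong +_ (sym (ℕP.+-suc (suc a) n)))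
        (upper∈plus a (ℤP.drop‿+≤+ t≤a))
plus-column a -[1+ n ] (-a≤t , _) =
  subst (λ u → (+ suc a , u) ∈ plus a) index≡ (lower∈plus a (ℤP.drop‿+≤+ bound))
  where
  t = -[1+ n ]
  j = ∣ t +ℤ + a ∣
  index≡ : + suc j ≡ + suc a +ℤ t
  index≡ = trans (cong (+ 1 +ℤ_) (index-from-left -a≤t)) (one-plus-index a t)
  gap : ∀ a n → n - 0ℤ ≡ a - (+ 1 +ℤ (- (+ 1 +ℤ n) +ℤ a))
  gap = solve-∀
  bound : + suc j ≤ℤ + a
  bound = subst (_≤ℤ + a) (cong (+ 1 +ℤ_) (sym (index-from-left -a≤t)))
                (≤-by-equal-gap (gap (+ a) (+ n)) (+≤+ z≤n))

plus-Cross : ∀ a → Cross a (plus a) (+ suc a , + suc a)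
plus-Cross a t w = plus-row a t w , plus-column a t w

row-length : ∀ a → length (row a) ≡ suc (2 ℕ.* a)
row-length a = trans (length-map _ (upTo (suc (2 ℕ.* a)))) (length-upTo (suc (2 ℕ.* a)))

column-length : ∀ {A : Set} (f : ℕ → A) a → length (map f (upTo a)) ≡ a
column-length f a = trans (length-map f (upTo a)) (length-upTo a)

length-plus : ∀ a → length (plus a) ≡ suc (2 ℕ.* a) ℕ.+ (a ℕ.+ a)
length-plus a = begin
  length (row a ++ lower-column a ++ upper-column a)
    ≡⟨ length-++ (row a) ⟩
  length (row a) ℕ.+ length (lower-column a ++ upper-column a)
    ≡⟨ cong (length (row a) ℕ.+_) (length-++ (lower-column a)) ⟩
  length (row a) ℕ.+ (length (lower-column a) ℕ.+ length (upper-column a))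
    ≡⟨ cong₂ ℕ._+_ (row-length a) (cong₂ ℕ._+_ (column-length _ a) (column-length _ a)) ⟩
  suc (2 ℕ.* a) ℕ.+ (a ℕ.+ a) ∎
  where open ≡-Reasoning

plus-cell : ∀ a {x} → x ∈ plus a →
            ∃[ i ] ∃[ j ] x ≡ (+ suc i , + suc j) × i ≤ 2 ℕ.* a × j ≤ 2 ℕ.* a
plus-cell a x∈ with ∈-++⁻ (row a) x∈
... | inj₁ x∈row with ∈-map⁻ _ x∈row
...   | i , i∈ , refl = i , a , refl , ℕP.≤-pred (∈-upTo⁻ i∈) , a≤2a a
plus-cell a x∈ | inj₂ x∈columns with ∈-++⁻ (lower-column a) x∈columns
... | inj₁ x∈lower with ∈-map⁻ _ x∈lower
...   | j , j∈ , refl = a , j , refl , a≤2a a , ℕP.≤-trans (ℕP.<⇒≤ (∈-upTo⁻ j∈)) (a≤2a a)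
plus-cell a x∈ | inj₂ x∈columns | inj₂ x∈upper with ∈-map⁻ _ x∈upper
...   | j , j∈ , refl = a , suc a ℕ.+ j , refl , a≤2a a ,
          subst (ℕ._≤ 2 ℕ.* a) (ℕP.+-suc a j) (ℕP.+-monoʳ-≤ a (ℕP.≤-trans (∈-upTo⁻ j∈) (ℕP.m≤m+n a 0)))

central : ℕ → Polyomino
central a = shift (+ a) (+ a) (plus a)

centre : ℕ → ℤ
centre a = + suc a +ℤ + a

central-Cross : ∀ a → Cross a (central a) (centre a , centre a)
central-Cross a = Cross-shift (+ a) (+ a) (plus-Cross a)

central-InBoard : ∀ a → All (InBoard (length (plus a))) (central a)
central-InBoard a = tabulate in-board
  where
  ≤-side : ∀ {i} → i ≤ 2 ℕ.* a → + suc (i ℕ.+ a) ≤ℤ + length (plus a)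
  ≤-side {i} i≤2a = subst (λ n → + suc (i ℕ.+ a) ≤ℤ + n) (sym (length-plus a))
                      (+≤+ (s≤s (ℕP.+-mono-≤ i≤2a (ℕP.m≤m+n a a))))
  in-board : ∀ {x} → x ∈ central a → InBoard (length (plus a)) x
  in-board x∈ with ∈-map⁻ _ x∈
  ... | _ , y∈ , refl with plus-cell a y∈
  ...   | i , j , refl , i≤2a , j≤2a = (+≤+ (s≤s z≤n) , ≤-side i≤2a) , (+≤+ (s≤s z≤n) , ≤-side j≤2a)

centre-Within : ∀ a z → + 1 ≤ℤ z - + a → z +ℤ + a ≤ℤ + (suc (2 ℕ.* a) ℕ.+ (a ℕ.+ a)) →
                Within a (centre a - z)
centre-Within a z left right =
  ≤-by-equal-gap (gap-right (+ a) z) right , ≤-by-equal-gap (gap-left (+ a) z) left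
  where
  gap-right : ∀ a z → (+ 1 +ℤ (a +ℤ (a +ℤ 0ℤ)) +ℤ (a +ℤ a)) - (z +ℤ a) ≡ ((+ 1 +ℤ a) +ℤ a - z) - (- a)
  gap-right = solve-∀
  gap-left : ∀ a z → (z - a) - + 1 ≡ a - ((+ 1 +ℤ a) +ℤ a - z)
  gap-left = solve-∀

Cross-meets-central : ∀ a {Q x y} → Cross a Q (x , y) → All (InBoard (length (plus a))) Q →
                      ¬ Disjoint Q (central a)
Cross-meets-central a {Q} {x} {y} cross Q∈board =
  Cross-meet cross (central-Cross a) (centre-Within a x left right)
    (subst (Within a) (neg-minus (centre a) y) (Within-neg (centre-Within a y bottom top)))
  where
  n≡ = length-plus a
  end : ∀ {c} → c ∈ Q → InBoard (length (plus a)) c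
  end = lookup Q∈board
  left   = proj₁ (proj₁ (end (proj₁ (cross (- + a) (Within-neg-radius a)))))
  right  = subst (λ n → x +ℤ + a ≤ℤ + n) n≡ (proj₂ (proj₁ (end (proj₁ (cross (+ a) (Within-radius a))))))
  bottom = proj₁ (proj₂ (end (proj₂ (cross (- + a) (Within-neg-radius a)))))
  top    = subst (λ n → y +ℤ + a ≤ℤ + n) n≡ (proj₂ (proj₂ (end (proj₂ (cross (+ a) (Within-radius a))))))
  neg-minus : ∀ c y → - (c - y) ≡ y - c
  neg-minus = solve-∀

blocking-piece⇒ClumsyPackingNumberIs-1 :
  ∀ (Eqv : Polyomino → Polyomino → Set) P Z → Eqv P Z → All (InBoard (length P)) Z →
  (∀ Q → Eqv P Q → All (InBoard (length P)) Q → ¬ Disjoint Q Z) →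
  ClumsyPackingNumberIs Eqv P 1
blocking-piece⇒ClumsyPackingNumberIs-1 Eqv P Z P~Z Z∈board meets =
  (Z ∷ [] , ((P~Z ∷ []) , Z-valid , maximal) , refl) , at-least-one
  where
  Z-valid : ValidArrangement (length P) (Z ∷ [])
  Z-valid = (Z∈board ∷ []) , ([] ∷ [])
  maximal : ∀ Q → Eqv P Q → ¬ ValidArrangement (length P) (Q ∷ Z ∷ [])
  maximal Q P~Q ((Q∈board ∷ _) , ((Q#Z ∷ []) ∷ _)) = meets Q P~Q Q∈board Q#Z
  at-least-one : ∀ A → IsPacking Eqv P A → 1 ≤ length A
  at-least-one []      (_ , _ , nothing-fits) = ⊥-elim (nothing-fits Z P~Z Z-valid)
  at-least-one (_ ∷ _) _                      = s≤s z≤n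

FixedEquiv⇒FreeEquiv : ∀ {P Q} → FixedEquiv P Q → FreeEquiv P Q
FixedEquiv⇒FreeEquiv e = 0 , e

FreeEquiv-plus⇒Cross : ∀ a {Q} → FreeEquiv (plus a) Q → ∃[ c ] Cross a Q c
FreeEquiv-plus⇒Cross a (k , c , d , Q≃) =
  let ((x , y) , cross) = Cross-rotate k (plus-Cross a)
  in (x +ℤ c , y +ℤ d) , Cross-resp-≃ Q≃ (Cross-shift c d cross)

central-blocks : ∀ a Q → FreeEquiv (plus a) Q → All (InBoard (length (plus a))) Q →
                 ¬ Disjoint Q (central a)
central-blocks a Q P~Q = Cross-meets-central a (proj₂ (FreeEquiv-plus⇒Cross a P~Q))

theorem3p19 : (a : ℕ) → 1 ≤ a →
    ClumsyPackingNumberIs FixedEquiv (plus a) 1 × ClumsyPackingNumberIs FreeEquiv (plus a) 1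
theorem3p19 a _ =
  blocking-piece⇒ClumsyPackingNumberIs-1 FixedEquiv (plus a) (central a) central-fixed
    (central-InBoard a) (λ Q P~Q → central-blocks a Q (FixedEquiv⇒FreeEquiv P~Q)) ,
  blocking-piece⇒ClumsyPackingNumberIs-1 FreeEquiv (plus a) (central a)
    (FixedEquiv⇒FreeEquiv central-fixed) (central-InBoard a) (central-blocks a)
  where
  central-fixed : FixedEquiv (plus a) (central a)
  central-fixed = + a , + a , λ _ → ⇔-id _
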